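{- For any labelled sequent $\mathfrak{S}$: if $\mathrm{labCS}^\infty\vdash\mathfrak{S}$, then $\mathcal{M}\Vdash\mathfrak{S}$ for every Carlson model $\mathcal{M}$.
   Context: Formulas are built from a countable set $\mathtt{Prop}$ of propositional atoms by $A::=\bot\mid p\mid A\to A\mid\Box A\mid\triangle A$. A Carlson model is $\mathcal{M}=\langle W,\prec,M_0,M_1,V\rangle$ with $W$ a non-empty set, $\prec\subseteq W\times W$ transitive and conversely wellfounded (no infinite chain $w_0\prec w_1\prec\cdots$), $M_0,M_1\subseteq W$, and $V:\mathtt{Prop}\to\mathcal{P}(W)$. Truth: $\mathcal{M},x\nVdash\bot$; $\mathcal{M},x\Vdash p$ iff $x\in V(p)$; $\mathcal{M},x\Vdash A\to B$ iff $\mathcal{M},x\nVdash A$ or $\mathcal{M},x\Vdash B$; $\mathcal{M},x\Vdash\Box A$ iff $\mathcal{M},y\Vdash A$ for all $y$ with $x\prec y$ and $y\in M_0$; $\mathcal{M},x\Vdash\triangle A$ iff $\mathcal{M},y\Vdash A$ for all $y$ with $x\prec y$ and $y\in M_1$. Fix a countable set $\mathtt{Lab}$ of labels. A labelled formula is $x:A$; a relational atom is $xRy$ or $xSy$. A sequent $\mathfrak{S}=\mathcal{R},\Gamma\Rightarrow\Omega$ consists of a finite multiset $\mathcal{R}$ of relational atoms and finite multisets $\Gamma,\Omega$ of labelled formulas; $Lab(\mathfrak{S})$ is its set of labels. The rules of $\mathrm{labCS}^\infty$ (premisses / conclusion) are: (Id) no premiss, conclusion $\mathcal{R},\Gamma,x:p\Rightarrow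 x:p,\Omega$, $p\in\mathtt{Prop}$; ($\bot$) no premiss, conclusion $\mathcal{R},\Gamma,x:\bot\Rightarrow\Omega$; ($\to$R) from $\mathcal{R},\Gamma,x:A\Rightarrow x:B,\Omega$ infer $\mathcal{R},\Gamma\Rightarrow x:A\to B,\Omega$; ($\to$L) from $\mathcal{R},\Gamma\Rightarrow x:A,\Omega$ and $\mathcal{R},\Gamma,x:B\Rightarrow\Omega$ infer $\mathcal{R},\Gamma,x:A\to B\Rightarrow\Omega$; ($\Box$R) from $\mathcal{R},xRy,\Gamma\Rightarrow y:A,\Omega$ infer $\mathcal{R},\Gamma\Rightarrow x:\Box A,\Omega$, $y$ not occurring in the conclusion; ($\Box$L) from $\mathcal{R},xRy,x:\Box A,y:A,\Gamma\Rightarrow\Omega$ infer $\mathcal{R},xRy,x:\Box A,\Gamma\Rightarrow\Omega$; ($\triangle$R) from $\mathcal{R},xSy,\Gamma\Rightarrow y:A,\Omega$ infer $\mathcal{R},\Gamma\Rightarrow x:\triangle A,\Omega$, $y$ not occurring in the conclusion; ($\triangle$L) from $\mathcal{R},xSy,x:\triangle A,y:A,\Gamma\Rightarrow\Omega$ infer $\mathcal{R},xSy,x:\triangle A,\Gamma\Rightarrow\Omega$; ($\mathrm{trans}_{\circ\bullet}$, $\circ,\bullet\in\{R,S\}$) from $\mathcal{R},x\circ y,y\bullet z,x\bullet z,\Gamma\Rightarrow\Omega$ infer $\mathcal{R},x\circ y,y\bullet z,\Gamma\Rightarrow\Omega$. A pre-proof is a possibly infinite tree of sequents in which every node together with its children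 forms an instance of one of these rules (the node being the conclusion, the children the premisses). Given an infinite branch $(\mathfrak{S}_i)_{i<\omega}$ with $\mathfrak{S}_i=\mathcal{R}_i,\Gamma_i\Rightarrow\Omega_i$, a trace is a sequence of labels $(x_i)_{i<\omega}$ such that for every $i$: $x_{i+1}=x_i$, or $x_iRx_{i+1}\in\mathcal{R}_i$, or $x_iSx_{i+1}\in\mathcal{R}_i$. A trace is progressing if it is not eventually constant, i.e. the second or third case applies infinitely often. A branch is progressing if it has a progressing trace. A proof is a pre-proof in which every branch is finite or progressing; $\mathrm{labCS}^\infty\vdash\mathfrak{S}$ means there is a proof with root $\mathfrak{S}$. A sequent interpretation of $\mathfrak{S}=\mathcal{R},\Gamma\Rightarrow\Omega$ on $\mathcal{M}$ is a map $I:Lab(\mathfrak{S})\to W$ such that $xRy\in\mathcal{R}$ implies $I(x)\prec I(y)$ and $I(y)\in M_0$, and $xSy\in\mathcal{R}$ implies $I(x)\prec I(y)$ and $I(y)\in M_1$. $\mathcal{M}\Vdash\mathfrak{S}$ means: for every sequent interpretation $I$ of $\mathfrak{S}$ on $\mathcal{M}$, if $\mathcal{M},I(x)\Vdash A$ for all $x:A\in\Gamma$, then $\mathcal{M},I(y)\Vdash B$ for some $y:B\in\Omega$. -}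

module Defs where

open import Level using (0ℓ)
open import Data.Nat using (ℕ; suc; _≤_)
open import Data.Empty using (⊥)
open import Data.Product using (Σ; ∃; ∃₂; _×_; _,_; proj₁)
open import Data.Sum using (_⊎_)
open import Data.List using (List; []; _∷_; _++_; [_]; map)
open import Data.List.Membership.Propositional using (_∈_; _∉_)
open import Data.List.Relation.Unary.All as All using (All)
open import Data.List.Relation.Unary.Any using (Any)
open import Data.List.Relation.Binary.Pointwise using (Pointwise)
open import Data.List.Relation.Binary.Permutation.Propositional using (_↭_)
open import Relation.Binary.PropositionalEquality using (_≡_)
open import Relation.Nullary using (¬_)

Atom : Set
Atom = ℕ

infixr 8 _⇒_
data Fm : Set where
  ⊥'   : Fm
  atom : Atom → Fm
  _⇒_  : Fm → Fm → Fm
  □    : Fm → Fm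
  △    : Fm → Fm

-- Labels, relational atoms, labelled formulas, sequents.
-- Multisets are represented by lists, taken up to permutation (_↭_).

Lab : Set
Lab = ℕ

data Kind : Set where
  R S : Kind

data RelAtom : Set where
  rel : Kind → Lab → Lab → RelAtom

record LFm : Set where
  constructor _∶_
  field
    lab : Lab
    fm  : Fm
open LFm public

infix 3 _∣_⇒_
record Sequent : Set where
  constructor _∣_⇒_
  field
    rels : List RelAtom
    ante : List LFm
    succ : List LFm
open Sequent public

labsR : List RelAtom → List Lab
labsR []                 = []
labsR (rel _ x y ∷ ρ)    = x ∷ y ∷ labsR ρ

labsF : List LFm → List Lab
labsF []              = []
labsF ((x ∶ _) ∷ Γ)   = x ∷ labsF Γ

labs : Sequent → List Lab
labs (ρ ∣ Γ ⇒ Ω) = labsR ρ ++ labsF Γ ++ labsF Ω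

data Rule : List Sequent → Sequent → Set where
  Id   : ∀ {ρ Γ Ω x p} →
         Rule [] (ρ ∣ (x ∶ atom p) ∷ Γ ⇒ (x ∶ atom p) ∷ Ω)
  Bot  : ∀ {ρ Γ Ω x} →
         Rule [] (ρ ∣ (x ∶ ⊥') ∷ Γ ⇒ Ω)
  ImpR : ∀ {ρ Γ Ω x A B} →
         Rule [ ρ ∣ (x ∶ A) ∷ Γ ⇒ (x ∶ B) ∷ Ω ]
              (ρ ∣ Γ ⇒ (x ∶ (A ⇒ B)) ∷ Ω)
  ImpL : ∀ {ρ Γ Ω x A B} →
         Rule ((ρ ∣ Γ ⇒ (x ∶ A) ∷ Ω) ∷ (ρ ∣ (x ∶ B) ∷ Γ ⇒ Ω) ∷ [])
              (ρ ∣ (x ∶ (A ⇒ B)) ∷ Γ ⇒ Ω)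
  BoxR : ∀ {ρ Γ Ω x y A} →
         y ∉ labs (ρ ∣ Γ ⇒ (x ∶ □ A) ∷ Ω) →
         Rule [ rel R x y ∷ ρ ∣ Γ ⇒ (y ∶ A) ∷ Ω ]
              (ρ ∣ Γ ⇒ (x ∶ □ A) ∷ Ω)
  BoxL : ∀ {ρ Γ Ω x y A} →
         Rule [ rel R x y ∷ ρ ∣ (x ∶ □ A) ∷ (y ∶ A) ∷ Γ ⇒ Ω ]
              (rel R x y ∷ ρ ∣ (x ∶ □ A) ∷ Γ ⇒ Ω)
  TriR : ∀ {ρ Γ Ω x y A} →
         y ∉ labs (ρ ∣ Γ ⇒ (x ∶ △ A) ∷ Ω) →
         Rule [ rel S x y ∷ ρ ∣ Γ ⇒ (y ∶ A) ∷ Ω ]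
              (ρ ∣ Γ ⇒ (x ∶ △ A) ∷ Ω)
  TriL : ∀ {ρ Γ Ω x y A} →
         Rule [ rel S x y ∷ ρ ∣ (x ∶ △ A) ∷ (y ∶ A) ∷ Γ ⇒ Ω ]
              (rel S x y ∷ ρ ∣ (x ∶ △ A) ∷ Γ ⇒ Ω)
  Trans : ∀ {ρ Γ Ω x y z} (∘ • : Kind) →
         Rule [ rel ∘ x y ∷ rel • y z ∷ rel • x z ∷ ρ ∣ Γ ⇒ Ω ]
              (rel ∘ x y ∷ rel • y z ∷ ρ ∣ Γ ⇒ Ω)

_≈ˢ_ : Sequent → Sequent → Set
𝔖 ≈ˢ 𝔗 = (rels 𝔖 ↭ rels 𝔗) × (ante 𝔖 ↭ ante 𝔗) × (succ 𝔖 ↭ succ 𝔗)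

Inst : List Sequent → Sequent → Set
Inst ps c = ∃₂ λ ps' c' → Rule ps' c' × Pointwise _≈ˢ_ ps ps' × (c ≈ˢ c')

-- A tree is presented as a set of
-- nodes T with a root, a sequent at each node and a list of children at
-- each node; the tree meant is the unravelling from the root (branches =
-- paths from the root).

record PreProof (𝔖 : Sequent) : Set₁ where
  field
    T        : Set
    root     : T
    seqOf    : T → Sequent
    children : T → List T
    rootSeq  : seqOf root ≡ 𝔖
    valid    : ∀ t → Inst (map seqOf (children t)) (seqOf t)
open PreProof public

record Branch {𝔖 : Sequent} (π : PreProof 𝔖) : Set where
  field
    node  : ℕ → T π
    start : node 0 ≡ root π
    step  : ∀ i → node (suc i) ∈ children π (node i)
open Branch public

seqAt : ∀ {𝔖} {π : PreProof 𝔖} → Branch π → ℕ → Sequent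
seqAt {π = π} b i = seqOf π (node b i)

IsTrace : ∀ {𝔖} {π : PreProof 𝔖} → Branch π → (ℕ → Lab) → Set
IsTrace b x = ∀ i → (x (suc i) ≡ x i)
                  ⊎ (rel R (x i) (x (suc i)) ∈ rels (seqAt b i))
                  ⊎ (rel S (x i) (x (suc i)) ∈ rels (seqAt b i))

Progressing : ∀ {𝔖} {π : PreProof 𝔖} → Branch π → (ℕ → Lab) → Set
Progressing b x = ∀ n → ∃ λ m → n ≤ m ×
  ((rel R (x m) (x (suc m)) ∈ rels (seqAt b m))
   ⊎ (rel S (x m) (x (suc m)) ∈ rels (seqAt b m)))

-- every infinite branch has a progressing trace
-- (finite branches end in leaves, i.e. zero-premiss rule instances)
IsProof : ∀ {𝔖} → PreProof 𝔖 → Set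
IsProof π = ∀ (b : Branch π) → ∃ λ x → IsTrace b x × Progressing b x

Derivable : Sequent → Set₁
Derivable 𝔖 = Σ (PreProof 𝔖) IsProof

record CarlsonModel : Set₁ where
  field
    W        : Set
    inhabited : W
    _≺_      : W → W → Set
    ≺-trans  : ∀ {u v w} → u ≺ v → v ≺ w → u ≺ w
    cwf      : ¬ (Σ (ℕ → W) λ f → ∀ i → f i ≺ f (suc i))
    M₀ M₁    : W → Set
    V        : Atom → W → Set

module _ (𝓜 : CarlsonModel) where
  open CarlsonModel 𝓜

  _⊩_ : W → Fm → Set
  w ⊩ ⊥'      = ⊥
  w ⊩ atom p  = V p w
  w ⊩ (A ⇒ B) = (¬ (w ⊩ A)) ⊎ (w ⊩ B)
  w ⊩ □ A     = ∀ v → w ≺ v → M₀ v → v ⊩ A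
  w ⊩ △ A     = ∀ v → w ≺ v → M₁ v → v ⊩ A

  -- sequent interpretation (labels mapped totally; only Lab(𝔖) matters)
  IsInterp : (Lab → W) → Sequent → Set
  IsInterp I 𝔖 =
    (∀ x y → rel R x y ∈ rels 𝔖 → (I x ≺ I y) × M₀ (I y)) ×
    (∀ x y → rel S x y ∈ rels 𝔖 → (I x ≺ I y) × M₁ (I y))

  Valid : Sequent → Set
  Valid 𝔖 = ∀ (I : Lab → W) → IsInterp I 𝔖 →
            All (λ φ → I (lab φ) ⊩ fm φ) (ante 𝔖) →
            Any (λ φ → I (lab φ) ⊩ fm φ) (succ 𝔖)

{-# OPTIONS --safe #-}
module Submission where

-- A model refuting a sequent refutes some premiss of every rule instance with
-- that conclusion, under an interpretation agreeing with the old one on the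
-- labels of the conclusion: for □R and △R the fresh label is sent to a world
-- witnessing, classically, the failure of the modal formula.  Leaves cannot be
-- refuted, so a refuted root determines an infinite branch of refuted
-- sequents.  Labels are never lost going up a rule, so along a trace each step
-- maps to an equal or a ≺-greater world and each progressing step to a
-- ≺-greater one; a progressing trace thus yields an infinite ≺-chain,
-- contradicting converse well-foundedness.

open import Defs
open import Level using (0ℓ)
open import Axiom.ExcludedMiddle using (ExcludedMiddle)
open import Axiom.DoubleNegationElimination using (DoubleNegationElimination; em⇒dne)
open import Function using (_∘_)
open import Data.Nat using (ℕ; zero; suc; _≤_; _≤′_; ≤′-refl; ≤′-step; _≟_)
open import Data.Nat.Properties using (≤⇒≤′)
open import Data.Empty using (⊥-elim)
open import Data.Product using (Σ; ∃; _×_; _,_; proj₁; proj₂)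
open import Data.Sum using (inj₁; inj₂; [_,_])
open import Data.List using (List; []; _∷_)
open import Data.List.Membership.Propositional using (_∈_; _∉_; find; lose)
open import Data.List.Membership.Propositional.Properties using (∈-++⁺ˡ; ∈-++⁺ʳ; ∈-++⁻)
open import Data.List.Relation.Binary.Subset.Propositional using (_⊆_)
open import Data.List.Relation.Unary.All as All using (All; []; _∷_)
open import Data.List.Relation.Unary.All.Properties using (¬Any⇒All¬)
open import Data.List.Relation.Unary.Any as Any using (Any; here; there)
open import Data.List.Relation.Unary.Any.Properties using (map⁻)
open import Data.List.Relation.Binary.Pointwise using (Any-resp-Pointwise)
import Data.List.Relation.Binary.Pointwise.Properties as Pointwise
open import Data.List.Relation.Binary.Permutation.Propositional using (↭-sym)
open import Data.List.Relation.Binary.Permutation.Propositional.Properties using (∈-resp-↭; All-resp-↭)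
open import Relation.Binary.Definitions using (Transitive)
open import Relation.Binary.Construct.Closure.Reflexive as Refl using (ReflClosure)
import Relation.Binary.Construct.Closure.Reflexive.Properties as ReflClosure
open import Relation.Binary.PropositionalEquality using (_≡_; _≢_; refl; sym; subst; subst₂)
open import Relation.Nullary using (¬_; yes; no)

module _ {W : Set} {_≺_ : W → W → Set} (≺-trans : Transitive _≺_) where

  private
    _≼_ : W → W → Set
    _≼_ = ReflClosure _≺_

    ≺-≼-trans : ∀ {a b c} → a ≺ b → b ≼ c → a ≺ c
    ≺-≼-trans a≺b Refl.refl    = a≺b
    ≺-≼-trans a≺b Refl.[ b≺c ] = ≺-trans a≺b b≺c

  ascending-subsequence :
    (P : ℕ → Set) (w : ℕ → W) →
    (∀ i → P i → w i ≼ w (suc i) × P (suc i)) →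
    (∀ n → ∃ λ m → n ≤ m × P m × w m ≺ w (suc m)) →
    Σ (ℕ → W) λ f → ∀ k → f k ≺ f (suc k)
  ascending-subsequence P w step strict = w ∘ index , ascends
    where
    ≼-from : ∀ {i j} → i ≤′ j → P i → w i ≼ w j × P j
    ≼-from ≤′-refl         pi = Refl.refl , pi
    ≼-from (≤′-step i≤′j) pi =
      let wi≼wj , pj = ≼-from i≤′j pi
          wj≼wsj , psj = step _ pj
      in ReflClosure.trans ≺-trans wi≼wj wj≼wsj , psj

    threshold : ℕ → ℕ
    threshold zero    = zero
    threshold (suc k) = suc (proj₁ (strict (threshold k)))

    index : ℕ → ℕ
    index k = proj₁ (strict (threshold k))

    ascends : ∀ k → w (index k) ≺ w (index (suc k))
    ascends k =
      let m , _ , pm , wm≺wsm = strict (threshold k)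
          _ , sm≤m′ , _ = strict (suc m)
      in ≺-≼-trans wm≺wsm (proj₁ (≼-from (≤⇒≤′ sm≤m′) (proj₂ (step m pm))))

labsR⁺ : ∀ {ρ k x y} → rel k x y ∈ ρ → x ∈ labsR ρ × y ∈ labsR ρ
labsR⁺ {rel _ _ _ ∷ _} (here refl) = here refl , there (here refl)
labsR⁺ {rel _ _ _ ∷ _} (there m)   =
  let x∈ , y∈ = labsR⁺ m in there (there x∈) , there (there y∈)

labsF⁺ : ∀ {Γ φ} → φ ∈ Γ → lab φ ∈ labsF Γ
labsF⁺ {_ ∷ _} (here refl) = here refl
labsF⁺ {_ ∷ _} (there m)   = there (labsF⁺ m)

labsR-⊆ : ∀ {ρ L} → (∀ {k x y} → rel k x y ∈ ρ → x ∈ L × y ∈ L) → labsR ρ ⊆ L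
labsR-⊆ {rel _ _ _ ∷ _} h (here refl)         = proj₁ (h (here refl))
labsR-⊆ {rel _ _ _ ∷ _} h (there (here refl)) = proj₂ (h (here refl))
labsR-⊆ {rel _ _ _ ∷ _} h (there (there m))   = labsR-⊆ (h ∘ there) m

labsF-⊆ : ∀ {Γ L} → (∀ {φ} → φ ∈ Γ → lab φ ∈ L) → labsF Γ ⊆ L
labsF-⊆ {_ ∷ _} h (here refl) = h (here refl)
labsF-⊆ {_ ∷ _} h (there m)   = labsF-⊆ (h ∘ there) m

labs⁺ʳ : ∀ 𝔖 {k x y} → rel k x y ∈ rels 𝔖 → x ∈ labs 𝔖 × y ∈ labs 𝔖
labs⁺ʳ (ρ ∣ Γ ⇒ Ω) m =
  let x∈ , y∈ = labsR⁺ m in ∈-++⁺ˡ x∈ , ∈-++⁺ˡ y∈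

labs⁺ᵃ : ∀ 𝔖 {φ} → φ ∈ ante 𝔖 → lab φ ∈ labs 𝔖
labs⁺ᵃ (ρ ∣ Γ ⇒ Ω) m = ∈-++⁺ʳ (labsR ρ) (∈-++⁺ˡ (labsF⁺ m))

labs⁺ˢ : ∀ 𝔖 {φ} → φ ∈ succ 𝔖 → lab φ ∈ labs 𝔖
labs⁺ˢ (ρ ∣ Γ ⇒ Ω) m = ∈-++⁺ʳ (labsR ρ) (∈-++⁺ʳ (labsF Γ) (labsF⁺ m))

labs-⊆ : ∀ {𝔖 L} →
         (∀ {k x y} → rel k x y ∈ rels 𝔖 → x ∈ L × y ∈ L) →
         (∀ {φ} → φ ∈ ante 𝔖 → lab φ ∈ L) →
         (∀ {φ} → φ ∈ succ 𝔖 → lab φ ∈ L) →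
         labs 𝔖 ⊆ L
labs-⊆ {ρ ∣ Γ ⇒ Ω} hr ha hs m =
  [ labsR-⊆ hr , [ labsF-⊆ ha , labsF-⊆ hs ] ∘ ∈-++⁻ (labsF Γ) ] (∈-++⁻ (labsR ρ) m)

labs-mono : ∀ c p →
            rels c ⊆ rels p →
            (∀ {φ} → φ ∈ ante c → lab φ ∈ labs p) →
            (∀ {φ} → φ ∈ succ c → lab φ ∈ labs p) →
            labs c ⊆ labs p
labs-mono c p hr = labs-⊆ {c} (labs⁺ʳ p ∘ hr)

rule-labs⊆ : ∀ {ps c} → Rule ps c → All (λ p → labs c ⊆ labs p) ps
rule-labs⊆ Id = []
rule-labs⊆ Bot = []
rule-labs⊆ {p ∷ _} {c} ImpR =
  labs-mono c p (λ m → m) (labs⁺ᵃ p ∘ there)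
    (λ { (here refl) → labs⁺ˢ p (here refl) ; (there m) → labs⁺ˢ p (there m) }) ∷ []
rule-labs⊆ {p ∷ q ∷ _} {c} ImpL =
  labs-mono c p (λ m → m)
    (λ { (here refl) → labs⁺ˢ p (here refl) ; (there m) → labs⁺ᵃ p m })
    (labs⁺ˢ p ∘ there) ∷
  labs-mono c q (λ m → m)
    (λ { (here refl) → labs⁺ᵃ q (here refl) ; (there m) → labs⁺ᵃ q (there m) })
    (labs⁺ˢ q) ∷ []
rule-labs⊆ {p ∷ _} {c} (BoxR _) =
  labs-mono c p there (labs⁺ᵃ p)
    (λ { (here refl) → proj₁ (labs⁺ʳ p (here refl)) ; (there m) → labs⁺ˢ p (there m) }) ∷ []
rule-labs⊆ {p ∷ _} {c} (TriR _) =
  labs-mono c p there (labs⁺ᵃ p)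
    (λ { (here refl) → proj₁ (labs⁺ʳ p (here refl)) ; (there m) → labs⁺ˢ p (there m) }) ∷ []
rule-labs⊆ {p ∷ _} {c} BoxL =
  labs-mono c p (λ m → m)
    (λ { (here refl) → labs⁺ᵃ p (here refl) ; (there m) → labs⁺ᵃ p (there (there m)) })
    (labs⁺ˢ p) ∷ []
rule-labs⊆ {p ∷ _} {c} TriL =
  labs-mono c p (λ m → m)
    (λ { (here refl) → labs⁺ᵃ p (here refl) ; (there m) → labs⁺ᵃ p (there (there m)) })
    (labs⁺ˢ p) ∷ []
rule-labs⊆ {p ∷ _} {c} (Trans _ _) =
  labs-mono c p (λ { (here refl) → here refl ; (there (here refl)) → there (here refl)
               ; (there (there m)) → there (there (there m)) })
    (labs⁺ᵃ p) (labs⁺ˢ p) ∷ []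

≈ˢ-sym : ∀ {c c′} → c ≈ˢ c′ → c′ ≈ˢ c
≈ˢ-sym (r , a , s) = ↭-sym r , ↭-sym a , ↭-sym s

labs-resp-≈ˢ : ∀ {c c′} → c ≈ˢ c′ → labs c ⊆ labs c′
labs-resp-≈ˢ {c} {c′} (r , a , s) =
  labs-mono c c′ (∈-resp-↭ r) (labs⁺ᵃ c′ ∘ ∈-resp-↭ a) (labs⁺ˢ c′ ∘ ∈-resp-↭ s)

module Soundness (em : ExcludedMiddle 0ℓ) (𝓜 : CarlsonModel) where
  open CarlsonModel 𝓜

  dne : DoubleNegationElimination 0ℓ
  dne = em⇒dne em

  _⊩ᴹ_ : W → Fm → Set
  _⊩ᴹ_ = _⊩_ 𝓜

  Marked : Kind → W → Set
  Marked R = M₀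
  Marked S = M₁

  _⊨ʳ_ : (Lab → W) → RelAtom → Set
  I ⊨ʳ rel k x y = I x ≺ I y × Marked k (I y)

  _⊨_ : (Lab → W) → LFm → Set
  I ⊨ φ = I (lab φ) ⊩ᴹ fm φ

  record Refutes (I : Lab → W) (𝔖 : Sequent) : Set where
    constructor refutes
    field
      rels-hold : All (I ⊨ʳ_) (rels 𝔖)
      ante-hold : All (I ⊨_) (ante 𝔖)
      succ-fail : All (¬_ ∘ (I ⊨_)) (succ 𝔖)

  IsInterp⇒rels-hold : ∀ {I 𝔖} → IsInterp 𝓜 I 𝔖 → All (I ⊨ʳ_) (rels 𝔖)
  IsInterp⇒rels-hold (r , s) =
    All.tabulate λ { {rel R x y} m → r x y m ; {rel S x y} m → s x y m }

  refutes-resp-≈ˢ : ∀ {I c c′} → c ≈ˢ c′ → Refutes I c → Refutes I c′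
  refutes-resp-≈ˢ (r , a , s) (refutes rs as ns) =
    refutes (All-resp-↭ r rs) (All-resp-↭ a as) (All-resp-↭ s ns)

  refutes-agree : ∀ {I I′ 𝔖} → (∀ {z} → z ∈ labs 𝔖 → I′ z ≡ I z) →
                  Refutes I 𝔖 → Refutes I′ 𝔖
  refutes-agree {I} {I′} {𝔖} agree (refutes rs as ns) =
    refutes (All.tabulate rel-agree)
            (All.tabulate λ {φ} m → subst (_⊩ᴹ fm φ) (sym (agree (labs⁺ᵃ 𝔖 m))) (All.lookup as m))
            (All.tabulate λ {φ} m → subst (¬_ ∘ (_⊩ᴹ fm φ)) (sym (agree (labs⁺ˢ 𝔖 m))) (All.lookup ns m))
    where
    rel-agree : ∀ {a} → a ∈ rels 𝔖 → I′ ⊨ʳ a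
    rel-agree {rel k x y} m =
      let x∈ , y∈ = labs⁺ʳ 𝔖 m
      in subst₂ (λ u v → u ≺ v × Marked k v) (sym (agree x∈)) (sym (agree y∈)) (All.lookup rs m)

  _[_↦_] : (Lab → W) → Lab → W → Lab → W
  (I [ y ↦ v ]) z with z ≟ y
  ... | yes _ = v
  ... | no  _ = I z

  update-≡ : ∀ I y v → (I [ y ↦ v ]) y ≡ v
  update-≡ I y v with y ≟ y
  ... | yes _   = refl
  ... | no  y≢y = ⊥-elim (y≢y refl)

  update-≢ : ∀ I {y} v {z} → z ≢ y → (I [ y ↦ v ]) z ≡ I z
  update-≢ I {y} v {z} z≢y with z ≟ y
  ... | yes z≡y = ⊥-elim (z≢y z≡y)
  ... | no  _   = refl

  update-fresh : ∀ {I y v} {L : List Lab} → y ∉ L → ∀ {z} → z ∈ L → (I [ y ↦ v ]) z ≡ I z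
  update-fresh {I} {v = v} y∉ z∈ = update-≢ I v λ { refl → y∉ z∈ }

  modal-witness : ∀ {u} {M : W → Set} {A} → ¬ (∀ v → u ≺ v → M v → v ⊩ᴹ A) →
                  ∃ λ v → u ≺ v × M v × ¬ v ⊩ᴹ A
  modal-witness ¬∀ = dne λ ∄ → ¬∀ λ v u≺v mv → dne λ ¬A → ∄ (v , u≺v , mv , ¬A)

  record AgreeingRefutation (I : Lab → W) (c p : Sequent) : Set where
    constructor agreeing
    field
      interp  : Lab → W
      refuted : Refutes interp p
      agrees  : ∀ {z} → z ∈ labs c → interp z ≡ I z

  unchanged : ∀ {I c p} → Refutes I p → AgreeingRefutation I c p
  unchanged r = agreeing _ r λ _ → refl

  fresh-successor : ∀ {I k ρ Γ Ω x y A B} →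
                    y ∉ labs (ρ ∣ Γ ⇒ (x ∶ B) ∷ Ω) → Refutes I (ρ ∣ Γ ⇒ (x ∶ B) ∷ Ω) →
                    ∀ {v} → I x ≺ v → Marked k v → ¬ v ⊩ᴹ A →
                    AgreeingRefutation I (ρ ∣ Γ ⇒ (x ∶ B) ∷ Ω) (rel k x y ∷ ρ ∣ Γ ⇒ (y ∶ A) ∷ Ω)
  fresh-successor {I} {k} {ρ} {Γ} {Ω} {x} {y} {A} {B} y∉ r {v} x≺v mv ¬A
    with refutes-agree (update-fresh y∉) r
  ... | refutes rs as (_ ∷ ns) =
    agreeing (I [ y ↦ v ]) (refutes (new-rel ∷ rs) as (new-succ ∷ ns)) (update-fresh y∉)
    where
    new-rel : (I [ y ↦ v ]) ⊨ʳ rel k x y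
    new-rel rewrite update-fresh {I} {y} {v} y∉ (labs⁺ˢ (ρ ∣ Γ ⇒ (x ∶ B) ∷ Ω) (here refl))
                  | update-≡ I y v = x≺v , mv
    new-succ : ¬ (I [ y ↦ v ]) ⊨ (y ∶ A)
    new-succ rewrite update-≡ I y v = ¬A

  refuted-premiss : ∀ {I ps c} → Rule ps c → Refutes I c → Any (AgreeingRefutation I c) ps
  refuted-premiss Id (refutes _ (p ∷ _) (¬p ∷ _)) = ⊥-elim (¬p p)
  refuted-premiss Bot (refutes _ (() ∷ _) _)
  refuted-premiss ImpR (refutes rs as (¬A⇒B ∷ ns)) =
    here (unchanged (refutes rs (dne (¬A⇒B ∘ inj₁) ∷ as) (¬A⇒B ∘ inj₂ ∷ ns)))
  refuted-premiss ImpL (refutes rs (inj₁ ¬A ∷ as) ns) =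
    here (unchanged (refutes rs as (¬A ∷ ns)))
  refuted-premiss ImpL (refutes rs (inj₂ B ∷ as) ns) =
    there (here (unchanged (refutes rs (B ∷ as) ns)))
  refuted-premiss (BoxR {A = A} y∉) r@(refutes _ _ (¬□A ∷ _)) =
    let _ , x≺v , mv , ¬A = modal-witness {A = A} ¬□A in here (fresh-successor y∉ r x≺v mv ¬A)
  refuted-premiss (TriR {A = A} y∉) r@(refutes _ _ (¬△A ∷ _)) =
    let _ , x≺v , mv , ¬A = modal-witness {A = A} ¬△A in here (fresh-successor y∉ r x≺v mv ¬A)
  refuted-premiss BoxL (refutes rs@((x≺y , my) ∷ _) (□A ∷ as) ns) =
    here (unchanged (refutes rs (□A ∷ □A _ x≺y my ∷ as) ns))
  refuted-premiss TriL (refutes rs@((x≺y , my) ∷ _) (△A ∷ as) ns) =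
    here (unchanged (refutes rs (△A ∷ △A _ x≺y my ∷ as) ns))
  refuted-premiss (Trans _ _) (refutes ((x≺y , mxy) ∷ (y≺z , myz) ∷ rs) as ns) =
    here (unchanged (refutes ((x≺y , mxy) ∷ (y≺z , myz) ∷ (≺-trans x≺y y≺z , myz) ∷ rs) as ns))

  Refinement : (Lab → W) → Sequent → Sequent → Set
  Refinement I c p = labs c ⊆ labs p × AgreeingRefutation I c p

  refined-premiss : ∀ {I ps c} → Rule ps c → Refutes I c → Any (Refinement I c) ps
  refined-premiss rule r =
    let _ , p∈ , ar = find (refuted-premiss rule r)
    in lose p∈ (All.lookup (rule-labs⊆ rule) p∈ , ar)

  refinement-resp-premiss : ∀ {I c p p′} → p ≈ˢ p′ → Refinement I c p → Refinement I c p′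
  refinement-resp-premiss p≈ (c⊆p , agreeing I′ r agrees) =
    labs-resp-≈ˢ p≈ ∘ c⊆p , agreeing I′ (refutes-resp-≈ˢ p≈ r) agrees

  refinement-resp-conclusion : ∀ {I c c′ p} → c ≈ˢ c′ → Refinement I c′ p → Refinement I c p
  refinement-resp-conclusion c≈ (c′⊆p , agreeing I′ r agrees) =
    c′⊆p ∘ labs-resp-≈ˢ c≈ , agreeing I′ r (agrees ∘ labs-resp-≈ˢ c≈)

  refined-premiss-inst : ∀ {I ps c} → Inst ps c → Refutes I c → Any (Refinement I c) ps
  refined-premiss-inst (_ , _ , rule , ps≈ , c≈) r =
    Any-resp-Pointwise refinement-resp-premiss (Pointwise.symmetric ≈ˢ-sym ps≈)
      (Any.map (refinement-resp-conclusion c≈) (refined-premiss rule (refutes-resp-≈ˢ c≈ r)))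

  module RefutedBranch {𝔖 : Sequent} (π : PreProof 𝔖) where

    record State : Set where
      constructor state
      field
        vertex  : T π
        interp  : Lab → W
        refuted : Refutes interp (seqOf π vertex)
    open State

    sequent : State → Sequent
    sequent s = seqOf π (vertex s)

    advance : (s : State) →
              ∃ λ t → t ∈ children π (vertex s) × Refinement (interp s) (sequent s) (seqOf π t)
    advance s = find (map⁻ (refined-premiss-inst (valid π (vertex s)) (refuted s)))

    next : State → State
    next s = let t , _ , _ , agreeing I r _ = advance s in state t I r

    next-agrees : ∀ s {z} → z ∈ labs (sequent s) →
                  z ∈ labs (sequent (next s)) × interp (next s) z ≡ interp s z
    next-agrees s z∈ = let _ , _ , c⊆p , agreeing _ _ agrees = advance s in c⊆p z∈ , agrees z∈

    module _ {I : Lab → W} (r : Refutes I 𝔖) where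

      states : ℕ → State
      states zero    = state (root π) I (subst (Refutes I) (sym (rootSeq π)) r)
      states (suc i) = next (states i)

      branch : Branch π
      branch = record
        { node  = vertex ∘ states
        ; start = refl
        ; step  = λ i → proj₁ (proj₂ (advance (states i)))
        }

      trace-ascends : ∀ x → IsTrace branch x → Progressing branch x →
                      Σ (ℕ → W) λ f → ∀ k → f k ≺ f (suc k)
      trace-ascends x trace progressing =
        ascending-subsequence ≺-trans Occurs w trace-step strict-step
        where
        w : ℕ → W
        w i = interp (states i) (x i)

        -- Before its first progressing step a trace may sit on a label absent from
        -- the sequent, whose interpretation the next fresh label may change.
        Occurs : ℕ → Set
        Occurs i = x i ∈ labs (sequent (states i))

        rel-step : ∀ i {k} → rel k (x i) (x (suc i)) ∈ rels (sequent (states i)) →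
                   Occurs i × w i ≺ w (suc i) × Occurs (suc i)
        rel-step i m =
          let xi∈ , xsi∈ = labs⁺ʳ (sequent (states i)) m
              xsi∈′ , eq = next-agrees (states i) xsi∈
              wi≺ , _ = All.lookup (Refutes.rels-hold (refuted (states i))) m
          in xi∈ , subst (w i ≺_) (sym eq) wi≺ , xsi∈′

        trace-step : ∀ i → Occurs i → ReflClosure _≺_ (w i) (w (suc i)) × Occurs (suc i)
        trace-step i xi∈ with trace i
        ... | inj₁ xsi≡xi rewrite xsi≡xi =
          let xi∈′ , eq = next-agrees (states i) xi∈
          in subst (ReflClosure _≺_ (w i)) (sym eq) Refl.refl , xi∈′
        ... | inj₂ (inj₁ m) = let _ , wi≺ , o = rel-step i m in Refl.[ wi≺ ] , o
        ... | inj₂ (inj₂ m) = let _ , wi≺ , o = rel-step i m in Refl.[ wi≺ ] , o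

        strict-step : ∀ n → ∃ λ m → n ≤ m × Occurs m × w m ≺ w (suc m)
        strict-step n with progressing n
        ... | m , n≤m , inj₁ m∈ = let o , wm≺ , _ = rel-step m m∈ in m , n≤m , o , wm≺
        ... | m , n≤m , inj₂ m∈ = let o , wm≺ , _ = rel-step m m∈ in m , n≤m , o , wm≺

    no-refuted-root : IsProof π → ∀ {I} → ¬ Refutes I 𝔖
    no-refuted-root isProof r =
      let x , trace , progressing = isProof (branch r)
      in cwf (trace-ascends r x trace progressing)

theorem2 : ExcludedMiddle 0ℓ → (𝔖 : Sequent) → Derivable 𝔖 → (𝓜 : CarlsonModel) → Valid 𝓜 𝔖
theorem2 em 𝔖 (π , isProof) 𝓜 I isInterp ante-hold = dne λ ¬succ →
  no-refuted-root isProof (refutes (IsInterp⇒rels-hold {𝔖 = 𝔖} isInterp) ante-hold (¬Any⇒All¬ _ ¬succ))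
  where open Soundness em 𝓜
        open RefutedBranch π
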